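{- Let $G_1=(V,E_1)$ and $G_2=(V,E_2)$ be two graphs on the same vertex set $V$ with $|V|=m$ and $E_1\cap E_2=\emptyset$, let $\ell\ge 2$ be an integer, let $\delta_1$ be the minimum degree of $G_1$ and $\Delta_2$ the maximum degree of $G_2$, and suppose $$m\left(\frac{\ell^2-1}{\ell^2}+\alpha\right)\le\delta_1 \ \text{ with } 0<\alpha<\frac{1}{\ell^2},\qquad \Delta_2\le\sqrt{\frac{m\alpha-\ell}{3}},$$ and that $m$ is large enough. Let $\mathcal{D}$ be an almost-$\ell$-decomposition of $G_1$, and let $A$ and $B$ be the vertex sets of two of its classes. Let $a\in A$ and $b\in B$ be such that $\{a,b\}$ is an edge of neither $G_1$ nor $G_2$. If no two classes of $\mathcal{D}$ span an alternating-$(\ell,2,\ell,2)$-bag, then there exist a class $C$ of $\mathcal{D}$ and an element $c\in C$ such that $A$ and $C$ form a compound pair, and moreover $A-a+c$, $C-c+a$ together with the other classes of $\mathcal{D}$ form an almost-$\ell$-decomposition of $G_1$ in which no two classes span an alternating-$(\ell,2,\ell,2)$-bag, even when the edge $\{a,b\}$ is added to $G_2$.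
   Context: Edges of $G_1$ are called blue and edges of $G_2$ red. An almost-$\ell$-decomposition of $G_1$ is a system of $\lfloor m/\ell\rfloor$ vertex-disjoint copies of $K_\ell$ in $G_1$; the vertex sets of these copies are called classes. Two classes form a compound pair if their union spans a complete graph $K_{2\ell}$ in $G_1$. Two classes span an alternating-$(\ell,2,\ell,2)$-bag if there are two vertex-disjoint red edges, each joining a vertex of one class to a vertex of the other class. Here $A-a+c$ denotes $(A\setminus\{a\})\cup\{c\}$ and $C-c+a$ denotes $(C\setminus\{c\})\cup\{a\}$.
   Formalization: The parameter α in $0<\alpha<\frac{1}{\ell^2}$, which enters both degree bounds, ranges over the rationals. -}

module Defs where

open import Data.Nat as ℕ using (ℕ; zero; suc; _*_; _∸_)
import Data.Nat.DivMod as ℕD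
open import Data.Integer using (+_)
open import Data.Rational using (ℚ; _/_; 0ℚ)
open import Data.Bool using (Bool; true; false; _∨_)
open import Data.Fin using (Fin; _≟_)
open import Data.Fin.Subset using (Subset; _∈_; _∪_; _-_; ⁅_⁆; ∣_∣)
open import Data.Vec using (tabulate)
open import Data.Product using (Σ; ∃; _×_; _,_)
open import Data.Sum using (_⊎_)
open import Data.Empty using (⊥)
open import Relation.Nullary using (¬_; yes; no)
open import Relation.Binary.PropositionalEquality using (_≡_; _≢_)

ℕ→ℚ : ℕ → ℚ
ℕ→ℚ n = + n / 1

-- the fraction n/d as a rational (d = 0 never used; returns 0)
frac : ℕ → ℕ → ℚ
frac n zero    = 0ℚ
frac n (suc d) = + n / suc d

-- floor division ⌊n/d⌋ (d = 0 never used; returns 0)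
_div_ : ℕ → ℕ → ℕ
n div zero    = 0
n div (suc d) = n ℕD./ suc d

record Graph (m : ℕ) : Set where
  field
    adj   : Fin m → Fin m → Bool
    sym   : ∀ u v → adj u v ≡ adj v u
    irref : ∀ v → adj v v ≡ false
open Graph public

Edge : ∀ {m} → Graph m → Fin m → Fin m → Set
Edge G u v = adj G u v ≡ true

nbhd : ∀ {m} → Graph m → Fin m → Subset m
nbhd G v = tabulate (adj G v)

deg : ∀ {m} → Graph m → Fin m → ℕ
deg G v = ∣ nbhd G v ∣

EdgeDisjoint : ∀ {m} → Graph m → Graph m → Set
EdgeDisjoint G₁ G₂ = ∀ u v → Edge G₁ u v → ¬ Edge G₂ u v

EdgePlus : ∀ {m} → Graph m → Fin m → Fin m → Fin m → Fin m → Set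
EdgePlus G a b u v = Edge G u v ⊎ ((u ≡ a × v ≡ b) ⊎ (u ≡ b × v ≡ a))

Clique : ∀ {m} → Graph m → Subset m → Set
Clique G S = ∀ u v → u ∈ S → v ∈ S → u ≢ v → Edge G u v

Decomp : ℕ → ℕ → Set
Decomp m ℓ = Fin (m div ℓ) → Subset m

IsAlmostDecomp : ∀ {m} → Graph m → (ℓ : ℕ) → Decomp m ℓ → Set
IsAlmostDecomp {m} G ℓ D =
  (∀ i → ∣ D i ∣ ≡ ℓ) ×
  (∀ i j → i ≢ j → ∀ (v : Fin m) → v ∈ D i → v ∈ D j → ⊥) ×
  (∀ i → Clique G (D i))

CompoundPair : ∀ {m} → Graph m → Subset m → Subset m → Set
CompoundPair G X Y = Clique G (X ∪ Y)

-- X and Y span an alternating-(ℓ,2,ℓ,2)-bag w.r.t. the red relation R: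
-- two vertex-disjoint red edges, each joining X to Y
AltBag : ∀ {m} → (Fin m → Fin m → Set) → Subset m → Subset m → Set
AltBag {m} R X Y =
  Σ (Fin m) λ x₁ → Σ (Fin m) λ y₁ → Σ (Fin m) λ x₂ → Σ (Fin m) λ y₂ →
    x₁ ∈ X × y₁ ∈ Y × x₂ ∈ X × y₂ ∈ Y ×
    x₁ ≢ x₂ × y₁ ≢ y₂ × x₁ ≢ y₂ × x₂ ≢ y₁ ×
    R x₁ y₁ × R x₂ y₂

NoAltBag : ∀ {m} (ℓ : ℕ) → (Fin m → Fin m → Set) → Decomp m ℓ → Set
NoAltBag ℓ R D = ∀ i j → i ≢ j → ¬ AltBag R (D i) (D j)

swapDecomp : ∀ {m} (ℓ : ℕ) → Decomp m ℓ → Fin (m div ℓ) → Fin (m div ℓ) →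
             Fin m → Fin m → Decomp m ℓ
swapDecomp ℓ D iA iC a c i with i ≟ iA | i ≟ iC
... | yes _ | _     = (D iA - a) ∪ ⁅ c ⁆
... | no _  | yes _ = (D iC - c) ∪ ⁅ a ⁆
... | no _  | no _  = D i

-- Weigh every class C ≠ A by ℓ·#(blocked vertices of C) + #(vertices of C red-near A), where w
-- is red-near A if it is red-adjacent to a class containing a red neighbour of A, and w is blocked
-- if it misses a vertex of A in G₁ or is red-adjacent to a class containing b or a red neighbour
-- of a.  Every vertex lies in one class, so double counting bounds the total weight by
-- ℓ(ℓe + (Δ+1)ℓΔ) + ℓ²Δ², where e = m − 1 − δ₁ bounds the non-neighbours of a vertex; the degree
-- conditions make this less than ℓ(⌊m/ℓ⌋ − 1), so some class C ≠ A has weight < ℓ.  Then no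
-- vertex of C is blocked, whence A ∪ C is a blue clique and C ≠ B, and some c ∈ C is not red-near
-- A.  Exchanging a and c creates no alternating bag: a bag through c would make c red-near A, a
-- bag through a would block a vertex of C, and A − a + c, C − c + a lie in the blue clique A ∪ C.

module Submission where

open import Defs hiding (sym)
open import Data.Fin using (Fin)

module FinCounting where

  open import Data.Nat using (ℕ; zero; suc; _+_; _*_; _∸_; _≤_; _<_; z≤n; s≤s)
  import Data.Nat.Properties as ℕₚ
  open import Data.Nat.Properties using (≤-trans; ≤-reflexive; ≤-antisym; +-mono-≤; *-monoʳ-≤; m≤m+n; m≤n+m; <⇒≱)
  open import Data.Bool using (true; false; if_then_else_)
  open import Data.Fin using (Fin; zero; suc; _≟_; punchIn)
  import Data.Fin.Properties as Finₚ
  open import Data.Fin.Subset using (Subset; ∣_∣)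
  open import Data.Fin.Subset.Properties using (_∈?_)
  open import Data.Vec using ([]; _∷_)
  open import Data.Vec.Functional using (removeAt)
  open import Data.List using (allFin)
  import Data.List.Relation.Unary.All as All
  open import Data.List.Membership.Propositional.Properties using (∈-allFin)
  open import Data.List.Extrema ℕₚ.≤-totalOrder using (argmin; argmax; f[argmin]≤f[xs]; f[xs]≤f[argmax])
  open import Data.Product using (∃; _×_; _,_)
  open import Function using (_∘_)
  open import Relation.Nullary using (¬_; Dec; yes; no; does; contradiction; ¬?; _×-dec_; _⊎-dec_)
  open import Relation.Unary using (Pred; Decidable; _⊆_)
  open import Relation.Binary.PropositionalEquality using (_≡_; _≢_; refl; sym; trans; cong; cong₂)
  open import Algebra.Properties.Semiring.Sum ℕₚ.+-*-semiring
    using (sum; sum-cong-≗; ∑-comm; ∑-distrib-+; *-distribˡ-sum; *-distribʳ-sum; sum-remove)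
  open ℕₚ.≤-Reasoning

  sum-mono-≤ : ∀ {n} {f g : Fin n → ℕ} → (∀ i → f i ≤ g i) → sum f ≤ sum g
  sum-mono-≤ {zero}  f≤g = z≤n
  sum-mono-≤ {suc n} f≤g = +-mono-≤ (f≤g zero) (sum-mono-≤ (f≤g ∘ suc))

  lookup≤sum : ∀ {n} (f : Fin n → ℕ) i → f i ≤ sum f
  lookup≤sum f zero    = m≤m+n (f zero) _
  lookup≤sum f (suc i) = ≤-trans (lookup≤sum (f ∘ suc) i) (m≤n+m _ (f zero))

  sum-const : ∀ n c → sum {n} (λ _ → c) ≡ n * c
  sum-const zero    c = refl
  sum-const (suc n) c = cong (c +_) (sum-const n c)

  χ : ∀ {p} {P : Set p} → Dec P → ℕ
  χ d = if does d then 1 else 0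

  count : ∀ {n p} {P : Pred (Fin n) p} → Decidable P → ℕ
  count P? = sum (λ i → χ (P? i))

  χ-yes : ∀ {p} {P : Set p} (d : Dec P) → P → χ d ≡ 1
  χ-yes (yes _)  _  = refl
  χ-yes (no ¬px) px = contradiction px ¬px

  χ-no : ∀ {p} {P : Set p} (d : Dec P) → ¬ P → χ d ≡ 0
  χ-no (yes px) ¬px = contradiction px ¬px
  χ-no (no _)   _   = refl

  χ-mono : ∀ {p q} {P : Set p} {Q : Set q} (d : Dec P) (e : Dec Q) → (P → Q) → χ d ≤ χ e
  χ-mono (yes px) e P→Q = ≤-reflexive (sym (χ-yes e (P→Q px)))
  χ-mono (no _)   _ _   = z≤n

  count-mono : ∀ {n p q} {P : Pred (Fin n) p} {Q : Pred (Fin n) q} (P? : Decidable P) (Q? : Decidable Q) →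
               P ⊆ Q → count P? ≤ count Q?
  count-mono P? Q? P⊆Q = sum-mono-≤ (λ i → χ-mono (P? i) (Q? i) P⊆Q)

  count-cong : ∀ {n p q} {P : Pred (Fin n) p} {Q : Pred (Fin n) q} (P? : Decidable P) (Q? : Decidable Q) →
               P ⊆ Q → Q ⊆ P → count P? ≡ count Q?
  count-cong P? Q? P⊆Q Q⊆P = ≤-antisym (count-mono P? Q? P⊆Q) (count-mono Q? P? Q⊆P)

  module _ {n p q} {P : Pred (Fin n) p} {Q : Pred (Fin n) q} (P? : Decidable P) (Q? : Decidable Q) where

    count-∪ : count (λ i → P? i ⊎-dec Q? i) ≤ count P? + count Q?
    count-∪ = begin
      sum (λ i → χ (P? i ⊎-dec Q? i))  ≤⟨ sum-mono-≤ (λ i → pointwise (P? i) (Q? i)) ⟩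
      sum (λ i → χ (P? i) + χ (Q? i))  ≡⟨ ∑-distrib-+ (λ i → χ (P? i)) (λ i → χ (Q? i)) ⟩
      count P? + count Q?              ∎
      where
      pointwise : ∀ {i} (d : Dec (P i)) (e : Dec (Q i)) → χ (d ⊎-dec e) ≤ χ d + χ e
      pointwise (yes _) _       = s≤s z≤n
      pointwise (no _)  (yes _) = s≤s z≤n
      pointwise (no _)  (no _)  = z≤n

    count-∪-disjoint : (∀ i → P i → ¬ Q i) →
                       count (λ i → P? i ⊎-dec Q? i) ≡ count P? + count Q?
    count-∪-disjoint P∩Q=∅ = trans (sum-cong-≗ (λ i → pointwise (P∩Q=∅ i) (P? i) (Q? i)))
                                   (∑-distrib-+ (λ i → χ (P? i)) (λ i → χ (Q? i)))
      where
      pointwise : ∀ {i} → (P i → ¬ Q i) → (d : Dec (P i)) (e : Dec (Q i)) → χ (d ⊎-dec e) ≡ χ d + χ e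
      pointwise P∩Q=∅ (yes p) (yes q) = contradiction q (P∩Q=∅ p)
      pointwise _     (yes _) (no _)  = refl
      pointwise _     (no _)  (yes _) = refl
      pointwise _     (no _)  (no _)  = refl

  count-∅ : ∀ {n p} {P : Pred (Fin n) p} (P? : Decidable P) → (∀ i → ¬ P i) → count P? ≡ 0
  count-∅ {n} P? ∅ = trans (sum-cong-≗ (λ i → χ-no (P? i) (∅ i))) (trans (sum-const n 0) (ℕₚ.*-zeroʳ n))

  count-pos : ∀ {n p} {P : Pred (Fin n) p} (P? : Decidable P) {i} → P i → 1 ≤ count P?
  count-pos P? {i} Pi = ≤-trans (≤-reflexive (sym (χ-yes (P? i) Pi))) (lookup≤sum _ i)

  count-unique : ∀ {n p} {P : Pred (Fin n) p} (P? : Decidable P) →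
                 (∀ {i j} → P i → P j → i ≡ j) → count P? ≤ 1
  count-unique {zero}  _  _      = z≤n
  count-unique {suc n} P? unique with P? zero
  ... | yes P0 = s≤s (≤-reflexive (count-∅ (P? ∘ suc) (λ i Psi → zero≢suc (unique P0 Psi))))
    where
    zero≢suc : ∀ {i : Fin n} → zero ≢ suc i
    zero≢suc ()
  ... | no _   = count-unique (P? ∘ suc) (λ Pi Pj → Finₚ.suc-injective (unique Pi Pj))

  count-singleton : ∀ {n} (b : Fin n) → count (_≟ b) ≡ 1
  count-singleton b = ≤-antisym (count-unique (_≟ b) (λ i≡b j≡b → trans i≡b (sym j≡b))) (count-pos (_≟ b) refl)

  count-complement : ∀ {n p} {P : Pred (Fin n) p} (P? : Decidable P) → count P? + count (¬? ∘ P?) ≡ n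
  count-complement {n} {P = P} P? = begin-equality
    count P? + count (¬? ∘ P?)            ≡⟨ sym (∑-distrib-+ (λ i → χ (P? i)) (λ i → χ (¬? (P? i)))) ⟩
    sum (λ i → χ (P? i) + χ (¬? (P? i)))  ≡⟨ sum-cong-≗ (λ i → pointwise (P? i)) ⟩
    sum {n} (λ _ → 1)                     ≡⟨ trans (sum-const n 1) (ℕₚ.*-identityʳ n) ⟩
    n                                     ∎
    where
    pointwise : ∀ {i} (d : Dec (P i)) → χ d + χ (¬? d) ≡ 1
    pointwise (yes _) = refl
    pointwise (no _)  = refl

  count-<-witness : ∀ {n p q} {P : Pred (Fin n) p} {Q : Pred (Fin n) q} (P? : Decidable P) (Q? : Decidable Q) →
                    count P? < count Q? → ∃ λ i → Q i × ¬ P i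
  count-<-witness {P = P} {Q} P? Q? P<Q with Finₚ.any? (λ i → Q? i ×-dec ¬? (P? i))
  ... | yes witness = witness
  ... | no none     = contradiction (count-mono Q? P? Q⊆P) (<⇒≱ P<Q)
    where
    Q⊆P : Q ⊆ P
    Q⊆P {i} Qi with P? i
    ... | yes Pi = Pi
    ... | no ¬Pi = contradiction (i , Qi , ¬Pi) none

  count-⋃ : ∀ {n k p s r} {P : Pred (Fin n) p} {S : Pred (Fin k) s} {R : Fin k → Pred (Fin n) r}
            (P? : Decidable P) (S? : Decidable S) (R? : ∀ v → Decidable (R v)) {K : ℕ} →
            (∀ {w} → P w → ∃ λ v → S v × R v w) → (∀ {v} → S v → count (R? v) ≤ K) →
            count P? ≤ count S? * K
  count-⋃ {S = S} P? S? R? {K} cover bound = begin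
    sum (λ w → χ (P? w))                           ≤⟨ sum-mono-≤ covered ⟩
    sum (λ w → sum (λ v → χ (S? v) * χ (R? v w)))  ≡⟨ ∑-comm (λ w v → χ (S? v) * χ (R? v w)) ⟩
    sum (λ v → sum (λ w → χ (S? v) * χ (R? v w)))  ≡⟨ sum-cong-≗ (λ v → sym (*-distribˡ-sum (χ (S? v)) (λ w → χ (R? v w)))) ⟩
    sum (λ v → χ (S? v) * count (R? v))            ≤⟨ sum-mono-≤ (λ v → bounded (S? v)) ⟩
    sum (λ v → χ (S? v) * K)                       ≡⟨ sym (*-distribʳ-sum K (λ v → χ (S? v))) ⟩
    count S? * K                                   ∎
    where
    covered : ∀ w → χ (P? w) ≤ sum (λ v → χ (S? v) * χ (R? v w))
    covered w with P? w
    ... | no _   = z≤n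
    ... | yes Pw with cover Pw
    ...   | v , Sv , Rvw = ≤-trans (≤-reflexive (sym (cong₂ _*_ (χ-yes (S? v) Sv) (χ-yes (R? v w) Rvw))))
                                   (lookup≤sum (λ v → χ (S? v) * χ (R? v w)) v)
    bounded : ∀ {v} (d : Dec (S v)) → χ d * count (R? v) ≤ χ d * K
    bounded (yes Sv) = *-monoʳ-≤ 1 (bound Sv)
    bounded (no _)   = z≤n

  ∑-count-disjoint : ∀ {n k p q} {Q : Fin k → Pred (Fin n) q} {P : Pred (Fin n) p}
                     (Q? : ∀ j → Decidable (Q j)) (P? : Decidable P) →
                     (∀ {w j j′} → Q j w → Q j′ w → j ≡ j′) →
                     sum (λ j → count (λ w → Q? j w ×-dec P? w)) ≤ count P?
  ∑-count-disjoint Q? P? disjoint = begin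
    sum (λ j → sum (λ w → χ (Q? j w ×-dec P? w)))  ≡⟨ ∑-comm (λ j w → χ (Q? j w ×-dec P? w)) ⟩
    sum (λ w → sum (λ j → χ (Q? j w ×-dec P? w)))  ≤⟨ sum-mono-≤ pointwise ⟩
    count P?                                       ∎
    where
    pointwise : ∀ w → sum (λ j → χ (Q? j w ×-dec P? w)) ≤ χ (P? w)
    pointwise w with P? w
    ... | yes Pw = count-unique (λ j → Q? j w ×-dec yes Pw) (λ (Qj , _) (Qj′ , _) → disjoint Qj Qj′)
    ... | no ¬Pw = ≤-reflexive (count-∅ (λ j → Q? j w ×-dec no ¬Pw) (λ j (_ , Pw) → ¬Pw Pw))

  sum-≥-except : ∀ {n} (f : Fin n → ℕ) (i : Fin n) {c} → (∀ j → j ≢ i → c ≤ f j) → (n ∸ 1) * c ≤ sum f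
  sum-≥-except {suc n} f i {c} c≤f = begin
    n * c                     ≡⟨ sym (sum-const n c) ⟩
    sum {n} (λ _ → c)         ≤⟨ sum-mono-≤ (λ j → c≤f (punchIn i j) (Finₚ.punchInᵢ≢i i j)) ⟩
    sum (removeAt f i)        ≤⟨ m≤n+m _ (f i) ⟩
    f i + sum (removeAt f i)  ≡⟨ sym (sum-remove f) ⟩
    sum f                     ∎

  ∣p∣≡count : ∀ {n} (p : Subset n) → ∣ p ∣ ≡ count (_∈? p)
  ∣p∣≡count []          = refl
  ∣p∣≡count (true ∷ p)  = cong suc (∣p∣≡count p)
  ∣p∣≡count (false ∷ p) = ∣p∣≡count p

  minimiser : ∀ {n} (f : Fin n → ℕ) → Fin n → ∃ λ u → ∀ v → f u ≤ f v
  minimiser {n} f v₀ = argmin f v₀ (allFin n) , λ v → All.lookup (f[argmin]≤f[xs] {f = f} v₀ (allFin n)) (∈-allFin v)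

  maximiser : ∀ {n} (f : Fin n → ℕ) → Fin n → ∃ λ u → ∀ v → f v ≤ f u
  maximiser {n} f v₀ = argmax f v₀ (allFin n) , λ v → All.lookup (f[xs]≤f[argmax] {f = f} v₀ (allFin n)) (∈-allFin v)

module Graphs where

  open FinCounting
  open import Data.Nat using (zero; suc; _+_)
  import Data.Nat.Properties as ℕₚ
  import Data.Bool as Bool
  open import Data.Bool using (true; false)
  open import Data.Fin using (Fin; zero; suc; _≟_)
  open import Data.Fin.Subset using (Subset; _∈_; ∣_∣)
  open import Data.Vec using (tabulate)
  open import Data.Product using (_,_)
  open import Data.Sum using (_⊎_; inj₁; inj₂)
  open import Function using (_∘_)
  open import Relation.Nullary using (¬_; contradiction; ¬?; _⊎-dec_)
  open import Relation.Unary using (Pred; Decidable)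
  open import Relation.Binary.PropositionalEquality using (_≡_; _≢_; refl; sym; trans; cong)
  open ℕₚ.≤-Reasoning

  Edge? : ∀ {m} (G : Graph m) u → Decidable (Edge G u)
  Edge? G u v = adj G u v Bool.≟ true

  ∣tabulate∣≡count : ∀ {n} (f : Fin n → Bool.Bool) → ∣ tabulate f ∣ ≡ count (λ i → f i Bool.≟ true)
  ∣tabulate∣≡count {zero}  f = refl
  ∣tabulate∣≡count {suc n} f with f zero
  ... | true  = cong suc (∣tabulate∣≡count (f ∘ suc))
  ... | false = ∣tabulate∣≡count (f ∘ suc)

  deg≡count : ∀ {m} (G : Graph m) v → deg G v ≡ count (Edge? G v)
  deg≡count G v = ∣tabulate∣≡count (adj G v)

  Edge-sym : ∀ {m} (G : Graph m) {u v} → Edge G u v → Edge G v u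
  Edge-sym G {u} {v} uv = trans (Graph.sym G v u) uv

  NonNeighbour : ∀ {m} → Graph m → Fin m → Pred (Fin m) _
  NonNeighbour G v w = ¬ (w ≡ v ⊎ Edge G v w)

  NonNeighbour? : ∀ {m} (G : Graph m) v → Decidable (NonNeighbour G v)
  NonNeighbour? G v w = ¬? ((w ≟ v) ⊎-dec Edge? G v w)

  count-NonNeighbour : ∀ {m} (G : Graph m) v → count (NonNeighbour? G v) + suc (deg G v) ≡ m
  count-NonNeighbour {m} G v = begin-equality
    count (NonNeighbour? G v) + suc (deg G v)            ≡⟨ cong (λ d → count (NonNeighbour? G v) + suc d) (deg≡count G v) ⟩
    count (NonNeighbour? G v) + (1 + count (Edge? G v))  ≡⟨ cong (count (NonNeighbour? G v) +_) closed-neighbourhood ⟩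
    count (NonNeighbour? G v) + count ClosedNbr?         ≡⟨ ℕₚ.+-comm _ (count ClosedNbr?) ⟩
    count ClosedNbr? + count (NonNeighbour? G v)         ≡⟨ count-complement ClosedNbr? ⟩
    m                                                    ∎
    where
    ClosedNbr? : Decidable (λ w → w ≡ v ⊎ Edge G v w)
    ClosedNbr? w = (w ≟ v) ⊎-dec Edge? G v w

    closed-neighbourhood : 1 + count (Edge? G v) ≡ count ClosedNbr?
    closed-neighbourhood = sym (trans (count-∪-disjoint (_≟ v) (Edge? G v) loopless)
                                      (cong (_+ count (Edge? G v)) (count-singleton v)))
      where
      loopless : ∀ w → w ≡ v → ¬ Edge G v w
      loopless w refl vv = contradiction (trans (sym vv) (Graph.irref G v)) λ ()

  Clique-⊆ : ∀ {m} {G : Graph m} {X Y : Subset m} → (∀ {x} → x ∈ X → x ∈ Y) → Clique G Y → Clique G X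
  Clique-⊆ X⊆Y clique u v u∈X v∈X = clique u v (X⊆Y u∈X) (X⊆Y v∈X)

  module _ {m} {R R′ : Fin m → Fin m → Set} where

    AltBag-map : ∀ {X Y X′ Y′ : Subset m} → (∀ {x} → x ∈ X → x ∈ X′) → (∀ {y} → y ∈ Y → y ∈ Y′) →
                 (∀ {x y} → x ∈ X → y ∈ Y → R x y → R′ x y) → AltBag R X Y → AltBag R′ X′ Y′
    AltBag-map X⊆X′ Y⊆Y′ R⇒R′ (x₁ , y₁ , x₂ , y₂ , x₁∈ , y₁∈ , x₂∈ , y₂∈ , x₁≢x₂ , y₁≢y₂ , x₁≢y₂ , x₂≢y₁ , r₁ , r₂) =
      x₁ , y₁ , x₂ , y₂ , X⊆X′ x₁∈ , Y⊆Y′ y₁∈ , X⊆X′ x₂∈ , Y⊆Y′ y₂∈ , x₁≢x₂ , y₁≢y₂ , x₁≢y₂ , x₂≢y₁ ,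
      R⇒R′ x₁∈ y₁∈ r₁ , R⇒R′ x₂∈ y₂∈ r₂

  AltBag-sym : ∀ {m} {R : Fin m → Fin m → Set} {X Y : Subset m} → (∀ {x y} → R x y → R y x) →
               AltBag R X Y → AltBag R Y X
  AltBag-sym R-sym (x₁ , y₁ , x₂ , y₂ , x₁∈ , y₁∈ , x₂∈ , y₂∈ , x₁≢x₂ , y₁≢y₂ , x₁≢y₂ , x₂≢y₁ , r₁ , r₂) =
    y₁ , x₁ , y₂ , x₂ , y₁∈ , x₁∈ , y₂∈ , x₂∈ , y₁≢y₂ , x₁≢x₂ , x₂≢y₁ ∘ sym , x₁≢y₂ ∘ sym , R-sym r₁ , R-sym r₂

  EdgePlus-sym : ∀ {m} (G : Graph m) {a b u v} → EdgePlus G a b u v → EdgePlus G a b v u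
  EdgePlus-sym G (inj₁ uv)                = inj₁ (Edge-sym G uv)
  EdgePlus-sym G (inj₂ (inj₁ (u≡a , v≡b))) = inj₂ (inj₂ (v≡b , u≡a))
  EdgePlus-sym G (inj₂ (inj₂ (u≡b , v≡a))) = inj₂ (inj₁ (v≡a , u≡b))

  EdgePlus⇒Edge : ∀ {m} (G : Graph m) {a b u v} → u ≢ a → v ≢ a → EdgePlus G a b u v → Edge G u v
  EdgePlus⇒Edge G u≢a v≢a (inj₁ uv)              = uv
  EdgePlus⇒Edge G u≢a v≢a (inj₂ (inj₁ (u≡a , _))) = contradiction u≡a u≢a
  EdgePlus⇒Edge G u≢a v≢a (inj₂ (inj₂ (_ , v≡a))) = contradiction v≡a v≢a

module Swap where

  open FinCounting
  open import Data.Nat using (_+_)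
  import Data.Nat.Properties as ℕₚ
  open import Data.Bool using (true; false)
  open import Data.Fin using (Fin; _≟_)
  open import Data.Fin.Subset using (Subset; ∣_∣; _∈_; _∉_; _∪_; _─_; _-_; ⁅_⁆)
  open import Data.Fin.Subset.Properties
    using (_∈?_; p─q⊆p; x∈p∪q⁻; x∈p∪q⁺; x∈⁅x⁆; x∈⁅y⁆⇒x≡y; x∉⁅y⁆⇒x≢y; x∈p∧x≢y⇒x∈p-y)
  open import Data.Vec using (_∷_; here; there)
  open import Data.Product using (∃; ∃₂; _×_; _,_)
  open import Data.Sum using (_⊎_; inj₁; inj₂)
  open import Function using (_∘_)
  open import Relation.Nullary using (yes; no; contradiction; _⊎-dec_)
  open import Relation.Unary using (Decidable)
  open import Relation.Binary.PropositionalEquality using (_≡_; _≢_; refl; sym; trans; cong; subst)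
  open ℕₚ.≤-Reasoning

  x∈p─q⇒x∉q : ∀ {n} {x : Fin n} (p q : Subset n) → x ∈ p ─ q → x ∉ q
  x∈p─q⇒x∉q (_ ∷ p) (true  ∷ q) () here
  x∈p─q⇒x∉q (_ ∷ p) (true  ∷ q) (there x∈) (there x∈q) = x∈p─q⇒x∉q p q x∈ x∈q
  x∈p─q⇒x∉q (_ ∷ p) (false ∷ q) (there x∈) (there x∈q) = x∈p─q⇒x∉q p q x∈ x∈q

  x∈p-y⇒x≢y : ∀ {n} {x y : Fin n} {p : Subset n} → x ∈ p - y → x ≢ y
  x∈p-y⇒x≢y {y = y} {p} = x∉⁅y⁆⇒x≢y ∘ x∈p─q⇒x∉q p ⁅ y ⁆

  module _ {n} (p : Subset n) (a c : Fin n) where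

    ∈-exchange⁻ : ∀ {x} → x ∈ (p - a) ∪ ⁅ c ⁆ → (x ∈ p × x ≢ a) ⊎ x ≡ c
    ∈-exchange⁻ x∈ with x∈p∪q⁻ (p - a) ⁅ c ⁆ x∈
    ... | inj₁ x∈p-a = inj₁ (p─q⊆p p ⁅ a ⁆ x∈p-a , x∈p-y⇒x≢y x∈p-a)
    ... | inj₂ x∈⁅c⁆ = inj₂ (x∈⁅y⁆⇒x≡y c x∈⁅c⁆)

    ∈-exchange⁺ : ∀ {x} → (x ∈ p × x ≢ a) ⊎ x ≡ c → x ∈ (p - a) ∪ ⁅ c ⁆
    ∈-exchange⁺ (inj₁ (x∈p , x≢a)) = x∈p∪q⁺ (inj₁ (x∈p∧x≢y⇒x∈p-y x∈p x≢a))
    ∈-exchange⁺ (inj₂ refl)        = x∈p∪q⁺ (inj₂ (x∈⁅x⁆ c))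

    ∣exchange∣ : a ∈ p → c ∉ p → ∣ (p - a) ∪ ⁅ c ⁆ ∣ ≡ ∣ p ∣
    ∣exchange∣ a∈p c∉p = begin-equality
      ∣ p′ ∣          ≡⟨ ∣p∣≡count p′ ⟩
      count (_∈? p′)  ≡⟨ ℕₚ.+-cancelʳ-≡ 1 _ _ one-more ⟩
      count (_∈? p)   ≡⟨ sym (∣p∣≡count p) ⟩
      ∣ p ∣           ∎
      where
      p′ : Subset n
      p′ = (p - a) ∪ ⁅ c ⁆

      p′∪a⊆p∪c : ∀ {x} → x ∈ p′ ⊎ x ≡ a → x ∈ p ⊎ x ≡ c
      p′∪a⊆p∪c (inj₁ x∈p′) with ∈-exchange⁻ x∈p′
      ... | inj₁ (x∈p , _) = inj₁ x∈p
      ... | inj₂ x≡c       = inj₂ x≡c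
      p′∪a⊆p∪c (inj₂ refl) = inj₁ a∈p

      p∪c⊆p′∪a : ∀ {x} → x ∈ p ⊎ x ≡ c → x ∈ p′ ⊎ x ≡ a
      p∪c⊆p′∪a {x} (inj₁ x∈p) with x ≟ a
      ... | yes x≡a = inj₂ x≡a
      ... | no x≢a  = inj₁ (∈-exchange⁺ (inj₁ (x∈p , x≢a)))
      p∪c⊆p′∪a (inj₂ x≡c) = inj₁ (∈-exchange⁺ (inj₂ x≡c))

      p′∩a=∅ : ∀ x → x ∈ p′ → x ≢ a
      p′∩a=∅ x x∈p′ x≡a with ∈-exchange⁻ x∈p′
      ... | inj₁ (_ , x≢a) = x≢a x≡a
      ... | inj₂ refl      = c∉p (subst (_∈ p) (sym x≡a) a∈p)

      one-more : count (_∈? p′) + 1 ≡ count (_∈? p) + 1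
      one-more = begin-equality
        count (_∈? p′) + 1              ≡⟨ cong (count (_∈? p′) +_) (sym (count-singleton a)) ⟩
        count (_∈? p′) + count (_≟ a)   ≡⟨ sym (count-∪-disjoint (_∈? p′) (_≟ a) p′∩a=∅) ⟩
        count p′∪a?                     ≡⟨ count-cong p′∪a? p∪c? p′∪a⊆p∪c p∪c⊆p′∪a ⟩
        count p∪c?                      ≡⟨ count-∪-disjoint (_∈? p) (_≟ c) p∩c=∅ ⟩
        count (_∈? p) + count (_≟ c)    ≡⟨ cong (count (_∈? p) +_) (count-singleton c) ⟩
        count (_∈? p) + 1               ∎
        where
        p′∪a? : Decidable (λ x → x ∈ p′ ⊎ x ≡ a)
        p′∪a? x = (x ∈? p′) ⊎-dec (x ≟ a)
        p∪c? : Decidable (λ x → x ∈ p ⊎ x ≡ c)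
        p∪c? x = (x ∈? p) ⊎-dec (x ≟ c)
        p∩c=∅ : ∀ x → x ∈ p → x ≢ c
        p∩c=∅ x x∈p refl = c∉p x∈p

  AltBag-exchange : ∀ {m} {R : Fin m → Fin m → Set} {X Y : Subset m} {x z} →
    AltBag R ((X - x) ∪ ⁅ z ⁆) Y →
    AltBag R (X - x) Y ⊎ ∃₂ λ y₁ y₂ → y₁ ∈ Y × y₂ ∈ Y × R z y₁ × ∃ λ x₂ → x₂ ∈ X × x₂ ≢ x × R x₂ y₂
  AltBag-exchange {X = X} {x = x} {z} (x₁ , y₁ , x₂ , y₂ , x₁∈ , y₁∈ , x₂∈ , y₂∈ , x₁≢x₂ , y₁≢y₂ , x₁≢y₂ , x₂≢y₁ , r₁ , r₂)
    with ∈-exchange⁻ X x z x₁∈ | ∈-exchange⁻ X x z x₂∈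
  ... | inj₁ (x₁∈X , x₁≢x) | inj₁ (x₂∈X , x₂≢x) =
    inj₁ (x₁ , y₁ , x₂ , y₂ , x∈p∧x≢y⇒x∈p-y x₁∈X x₁≢x , y₁∈ , x∈p∧x≢y⇒x∈p-y x₂∈X x₂≢x , y₂∈ ,
          x₁≢x₂ , y₁≢y₂ , x₁≢y₂ , x₂≢y₁ , r₁ , r₂)
  ... | inj₂ refl          | inj₁ (x₂∈X , x₂≢x) = inj₂ (y₁ , y₂ , y₁∈ , y₂∈ , r₁ , x₂ , x₂∈X , x₂≢x , r₂)
  ... | inj₁ (x₁∈X , x₁≢x) | inj₂ refl          = inj₂ (y₂ , y₁ , y₂∈ , y₁∈ , r₂ , x₁ , x₁∈X , x₁≢x , r₁)
  ... | inj₂ refl          | inj₂ refl          = contradiction refl x₁≢x₂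

  module _ {m ℓ} (D : Decomp m ℓ) (iA iC : Fin (m div ℓ)) (a c : Fin m) where

    private
      A′ C′ : Subset m
      A′ = (D iA - a) ∪ ⁅ c ⁆
      C′ = (D iC - c) ∪ ⁅ a ⁆

    data ExchangeView (i : Fin (m div ℓ)) : Subset m → Set where
      at-A      : i ≡ iA → ExchangeView i A′
      at-C      : i ≢ iA → i ≡ iC → ExchangeView i C′
      elsewhere : i ≢ iA → i ≢ iC → ExchangeView i (D i)

    exchangeView : ∀ i → ExchangeView i (swapDecomp ℓ D iA iC a c i)
    exchangeView i with i ≟ iA | i ≟ iC
    ... | yes i≡iA | _        = at-A i≡iA
    ... | no i≢iA  | yes i≡iC = at-C i≢iA i≡iC
    ... | no i≢iA  | no i≢iC  = elsewhere i≢iA i≢iC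

    -- Abstracting the class together with its view refines it to A′, C′ or D i in each case.
    swapDecomp-all : ∀ {q} (Q : Subset m → Set q) → Q A′ → Q C′ → (∀ i → i ≢ iA → i ≢ iC → Q (D i)) →
                     ∀ i → Q (swapDecomp ℓ D iA iC a c i)
    swapDecomp-all Q QA′ QC′ Qothers i with swapDecomp ℓ D iA iC a c i | exchangeView i
    ... | _ | at-A _             = QA′
    ... | _ | at-C _ _           = QC′
    ... | _ | elsewhere i≢iA i≢iC = Qothers i i≢iA i≢iC

    swapDecomp-pairwise : ∀ {q} (Q : Subset m → Subset m → Set q) → (∀ {X Y} → Q X Y → Q Y X) →
      Q A′ C′ → (∀ j → j ≢ iA → j ≢ iC → Q A′ (D j)) → (∀ j → j ≢ iA → j ≢ iC → Q C′ (D j)) →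
      (∀ i j → i ≢ j → i ≢ iA → i ≢ iC → j ≢ iA → j ≢ iC → Q (D i) (D j)) →
      ∀ i j → i ≢ j → Q (swapDecomp ℓ D iA iC a c i) (swapDecomp ℓ D iA iC a c j)
    swapDecomp-pairwise Q Q-sym QA′C′ QA′O QC′O QOO i j i≢j
      with swapDecomp ℓ D iA iC a c i | exchangeView i | swapDecomp ℓ D iA iC a c j | exchangeView j
    ... | _ | at-A i≡iA           | _ | at-A j≡iA           = contradiction (trans i≡iA (sym j≡iA)) i≢j
    ... | _ | at-A _              | _ | at-C _ _            = QA′C′
    ... | _ | at-A _              | _ | elsewhere j≢iA j≢iC = QA′O j j≢iA j≢iC
    ... | _ | at-C _ _            | _ | at-A _              = Q-sym QA′C′
    ... | _ | at-C _ i≡iC         | _ | at-C _ j≡iC         = contradiction (trans i≡iC (sym j≡iC)) i≢j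
    ... | _ | at-C _ _            | _ | elsewhere j≢iA j≢iC = QC′O j j≢iA j≢iC
    ... | _ | elsewhere i≢iA i≢iC | _ | at-A _              = Q-sym (QA′O i i≢iA i≢iC)
    ... | _ | elsewhere i≢iA i≢iC | _ | at-C _ _            = Q-sym (QC′O i i≢iA i≢iC)
    ... | _ | elsewhere i≢iA i≢iC | _ | elsewhere j≢iA j≢iC = QOO i j i≢j i≢iA i≢iC j≢iA j≢iC

module Arithmetic where

  open import Data.Nat
  open import Data.Nat.Properties
  import Data.Nat.DivMod as ℕD
  open import Data.Nat.Tactic.RingSolver using (solve; solve-∀)
  open import Data.List using ([]; _∷_)
  open import Data.Empty using (⊥)
  open import Relation.Binary.PropositionalEquality using (_≡_; cong; sym; trans)
  open ≤-Reasoning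

  n≤n*n : ∀ n → n ≤ n * n
  n≤n*n zero      = z≤n
  n≤n*n n@(suc _) = m≤m*n n n

  m*[n∸1]+m≡m*n : ∀ m {n} → 1 ≤ n → m * (n ∸ 1) + m ≡ m * n
  m*[n∸1]+m≡m*n m {n} 1≤n = begin-equality
    m * (n ∸ 1) + m      ≡⟨ cong (m * (n ∸ 1) +_) (sym (*-identityʳ m)) ⟩
    m * (n ∸ 1) + m * 1  ≡⟨ sym (*-distribˡ-+ m (n ∸ 1) 1) ⟩
    m * (n ∸ 1 + 1)      ≡⟨ cong (m *_) (m∸n+n≡m 1≤n) ⟩
    m * n                ∎

  few-non-neighbours : ∀ {L m δ e} t → 1 ≤ L → m * (L ∸ 1) + L * t ≤ L * δ → e + suc δ ≡ m →
                       L * e + L * t + L ≤ m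
  few-non-neighbours {L} {m} {δ} {e} t 1≤L deg e+1+δ≡m = +-cancelˡ-≤ (m * (L ∸ 1)) _ _ (begin
    m * (L ∸ 1) + (L * e + L * t + L)     ≡⟨ regroup (m * (L ∸ 1)) (L * e) (L * t) L ⟩
    (m * (L ∸ 1) + L * t) + (L * e + L)   ≤⟨ +-monoˡ-≤ _ deg ⟩
    L * δ + (L * e + L)                   ≡⟨ solve (L ∷ δ ∷ e ∷ []) ⟩
    L * (e + suc δ)                       ≡⟨ cong (L *_) e+1+δ≡m ⟩
    L * m                                 ≡⟨ trans (*-comm L m) (sym (m*[n∸1]+m≡m*n m 1≤L)) ⟩
    m * (L ∸ 1) + m                       ∎)
    where
    regroup : ∀ x y z w → x + (y + z + w) ≡ (x + z) + (y + w)
    regroup = solve-∀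

  -- With L = ℓ², the degree condition gives L(e + 3Δ² + ℓ + 1) ≤ m, whereas the bound on the
  -- weights and m < ℓ⌊m/ℓ⌋ + ℓ give m < L(e + 2Δ² + Δ) + 2ℓ.
  counting-contradiction : ∀ {ℓ m n δ Δ e} → 2 ≤ ℓ → 1 ≤ n →
    m * (ℓ * ℓ ∸ 1) + ℓ * ℓ * (3 * (Δ * Δ) + ℓ) ≤ ℓ * ℓ * δ → e + suc δ ≡ m →
    suc m ≤ ℓ * n + ℓ →
    (n ∸ 1) * ℓ ≤ ℓ * (ℓ * e + (Δ + 1) * ℓ * Δ) + ℓ * Δ * ℓ * Δ → ⊥
  counting-contradiction {ℓ} {m} {suc n} {δ} {Δ} {e} 2≤ℓ (s≤s z≤n) deg e+1+δ≡m m<ℓn+ℓ weights =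
    1+n≰n (begin
      1 + (ℓ * ℓ * (Δ * Δ) + ℓ * ℓ * ℓ)           ≤⟨ m≤m+n _ (ℓ * ℓ) ⟩
      1 + (ℓ * ℓ * (Δ * Δ) + ℓ * ℓ * ℓ) + ℓ * ℓ  ≤⟨ +-cancelʳ-≤ (ℓ * ℓ * e + 2 * (ℓ * ℓ * (Δ * Δ))) _ _ both ⟩
      ℓ * ℓ * Δ + 2 * ℓ                          ≤⟨ +-mono-≤ (*-monoʳ-≤ (ℓ * ℓ) (n≤n*n Δ)) (*-monoˡ-≤ ℓ 2≤ℓ*ℓ) ⟩
      ℓ * ℓ * (Δ * Δ) + ℓ * ℓ * ℓ                ∎)
    where
    2≤ℓ*ℓ : 2 ≤ ℓ * ℓ
    2≤ℓ*ℓ = ≤-trans 2≤ℓ (m≤m*n ℓ ℓ {{>-nonZero (≤-trans (s≤s z≤n) 2≤ℓ)}})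

    both : 1 + (ℓ * ℓ * (Δ * Δ) + ℓ * ℓ * ℓ) + ℓ * ℓ + (ℓ * ℓ * e + 2 * (ℓ * ℓ * (Δ * Δ))) ≤
           ℓ * ℓ * Δ + 2 * ℓ + (ℓ * ℓ * e + 2 * (ℓ * ℓ * (Δ * Δ)))
    both = begin
      1 + (ℓ * ℓ * (Δ * Δ) + ℓ * ℓ * ℓ) + ℓ * ℓ + (ℓ * ℓ * e + 2 * (ℓ * ℓ * (Δ * Δ)))
        ≡⟨ solve (ℓ ∷ Δ ∷ e ∷ []) ⟩
      1 + (ℓ * ℓ * e + ℓ * ℓ * (3 * (Δ * Δ) + ℓ) + ℓ * ℓ)
        ≤⟨ s≤s (few-non-neighbours (3 * (Δ * Δ) + ℓ) (≤-trans (s≤s z≤n) 2≤ℓ*ℓ) deg e+1+δ≡m) ⟩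
      suc m
        ≤⟨ m<ℓn+ℓ ⟩
      ℓ * suc n + ℓ
        ≡⟨ solve (ℓ ∷ n ∷ []) ⟩
      n * ℓ + 2 * ℓ
        ≤⟨ +-monoˡ-≤ (2 * ℓ) weights ⟩
      ℓ * (ℓ * e + (Δ + 1) * ℓ * Δ) + ℓ * Δ * ℓ * Δ + 2 * ℓ
        ≡⟨ solve (ℓ ∷ e ∷ Δ ∷ []) ⟩
      ℓ * ℓ * Δ + 2 * ℓ + (ℓ * ℓ * e + 2 * (ℓ * ℓ * (Δ * Δ))) ∎

  m<ℓ*[m/ℓ]+ℓ : ∀ m {ℓ} → 1 ≤ ℓ → suc m ≤ ℓ * (m div ℓ) + ℓ
  m<ℓ*[m/ℓ]+ℓ m {ℓ@(suc _)} _ = begin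
    suc m                             ≡⟨ cong suc (ℕD.m≡m%n+[m/n]*n m ℓ) ⟩
    suc (m ℕD.% ℓ) + m div ℓ * ℓ    ≤⟨ +-monoˡ-≤ (m div ℓ * ℓ) (ℕD.m%n<n m ℓ) ⟩
    ℓ + m div ℓ * ℓ                 ≡⟨ trans (+-comm ℓ _) (cong (_+ ℓ) (*-comm (m div ℓ) ℓ)) ⟩
    ℓ * (m div ℓ) + ℓ               ∎

module DegreeConditions where

  open import Data.Nat as ℕ using (ℕ; suc; _∸_)
  import Data.Nat.Properties as ℕₚ
  open import Data.Nat.Coprimality using (1-coprimeTo)
  import Data.Nat.Coprimality as Coprime
  open import Data.Integer as ℤ using (+_)
  import Data.Integer.Properties as ℤₚ
  open import Data.Rational using (ℚ; mkℚ; _≤_; _+_; _-_; _*_; _/_; toℚᵘ; NonNegative)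
  open import Data.Rational.Properties
    using (normalize-coprime; drop-*≤*; toℚᵘ-injective; toℚᵘ-homo-*; toℚᵘ-fromℚᵘ;
           +-monoˡ-≤; +-monoʳ-≤; *-monoˡ-≤-nonNeg; module ≤-Reasoning)
  import Data.Rational.Unnormalised as ℚᵘ
  import Data.Rational.Unnormalised.Properties as ℚᵘₚ
  open import Data.Rational.Solver using (module +-*-Solver)
  open import Relation.Binary.PropositionalEquality using (_≡_; refl; sym; trans; cong; cong₂)

  ℕ→ℚ≡mkℚ : ∀ n → ℕ→ℚ n ≡ mkℚ (+ n) 0 (Coprime.sym (1-coprimeTo n))
  ℕ→ℚ≡mkℚ n = normalize-coprime (Coprime.sym (1-coprimeTo n))

  ℕ→ℚ-+ : ∀ x y → ℕ→ℚ x + ℕ→ℚ y ≡ ℕ→ℚ (x ℕ.+ y)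
  ℕ→ℚ-+ x y rewrite ℕ→ℚ≡mkℚ x | ℕ→ℚ≡mkℚ y =
    cong (_/ 1) (trans (cong₂ ℤ._+_ (ℤₚ.*-identityʳ (+ x)) (ℤₚ.*-identityʳ (+ y))) (sym (ℤₚ.pos-+ x y)))

  ℕ→ℚ-* : ∀ x y → ℕ→ℚ x * ℕ→ℚ y ≡ ℕ→ℚ (x ℕ.* y)
  ℕ→ℚ-* x y rewrite ℕ→ℚ≡mkℚ x | ℕ→ℚ≡mkℚ y = cong (_/ 1) (sym (ℤₚ.pos-* x y))

  ℕ→ℚ-cancel-≤ : ∀ x y → ℕ→ℚ x ≤ ℕ→ℚ y → x ℕ.≤ y
  ℕ→ℚ-cancel-≤ x y x≤y rewrite ℕ→ℚ≡mkℚ x | ℕ→ℚ≡mkℚ y with drop-*≤* x≤y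
  ... | x*1≤y*1 rewrite ℤₚ.*-identityʳ (+ x) | ℤₚ.*-identityʳ (+ y) = ℤₚ.drop‿+≤+ x*1≤y*1

  ℕ→ℚ-nonNeg : ∀ n → NonNegative (ℕ→ℚ n)
  ℕ→ℚ-nonNeg n rewrite ℕ→ℚ≡mkℚ n = _

  frac*denominator : ∀ n {d} → 1 ℕ.≤ d → frac n d * ℕ→ℚ d ≡ ℕ→ℚ n
  frac*denominator n {suc d} _ = toℚᵘ-injective (ℚᵘₚ.≃-trans (toℚᵘ-homo-* (frac n (suc d)) (ℕ→ℚ (suc d)))
    (ℚᵘₚ.≃-trans (ℚᵘₚ.*-cong (toℚᵘ-fromℚᵘ (ℚᵘ.mkℚᵘ (+ n) d)) (ℚᵘₚ.≃-reflexive (cong toℚᵘ (ℕ→ℚ≡mkℚ (suc d)))))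
    (ℚᵘₚ.≃-trans (ℚᵘ.*≡* cross) (ℚᵘₚ.≃-reflexive (cong toℚᵘ (sym (ℕ→ℚ≡mkℚ n)))))))
    where
    cross : (+ n ℤ.* + suc d) ℤ.* + 1 ≡ + n ℤ.* + suc (d ℕ.* 1)
    cross = trans (ℤₚ.*-identityʳ _) (cong (λ k → + n ℤ.* + suc k) (sym (ℕₚ.*-identityʳ d)))

  -- Multiply the condition on δ by ℓ² and add ℓ² times the condition on Δ.
  degree-conditions-ℕ : ∀ ℓ m δ Δ (α : ℚ) → 1 ℕ.≤ ℓ →
    ℕ→ℚ m * (frac (ℓ ℕ.* ℓ ∸ 1) (ℓ ℕ.* ℓ) + α) ≤ ℕ→ℚ δ →
    ℕ→ℚ (3 ℕ.* (Δ ℕ.* Δ)) ≤ ℕ→ℚ m * α - ℕ→ℚ ℓ →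
    m ℕ.* (ℓ ℕ.* ℓ ∸ 1) ℕ.+ ℓ ℕ.* ℓ ℕ.* (3 ℕ.* (Δ ℕ.* Δ) ℕ.+ ℓ) ℕ.≤ ℓ ℕ.* ℓ ℕ.* δ
  degree-conditions-ℕ ℓ m δ Δ α 1≤ℓ dense sparse = ℕ→ℚ-cancel-≤ _ _ (begin
    ℕ→ℚ (m ℕ.* (L ∸ 1) ℕ.+ L ℕ.* (t ℕ.+ ℓ))
      ≡⟨ sym homomorphic ⟩
    x * (F * ℕ→ℚ L) + ℕ→ℚ L * (ℕ→ℚ t + ℕ→ℚ ℓ)
      ≤⟨ +-monoʳ-≤ (x * (F * ℕ→ℚ L)) (*-monoˡ-≤-nonNeg (ℕ→ℚ L) {{ℕ→ℚ-nonNeg L}} (+-monoˡ-≤ (ℕ→ℚ ℓ) sparse)) ⟩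
    x * (F * ℕ→ℚ L) + ℕ→ℚ L * (x * α - ℕ→ℚ ℓ + ℕ→ℚ ℓ)
      ≡⟨ solve 5 (λ x F a L l → x :* (F :* L) :+ L :* (x :* a :- l :+ l) := L :* (x :* (F :+ a)))
               refl x F α (ℕ→ℚ L) (ℕ→ℚ ℓ) ⟩
    ℕ→ℚ L * (x * (F + α))
      ≤⟨ *-monoˡ-≤-nonNeg (ℕ→ℚ L) {{ℕ→ℚ-nonNeg L}} dense ⟩
    ℕ→ℚ L * ℕ→ℚ δ
      ≡⟨ ℕ→ℚ-* L δ ⟩
    ℕ→ℚ (L ℕ.* δ) ∎)
    where
    open ≤-Reasoning
    open +-*-Solver
    L t : ℕ
    L = ℓ ℕ.* ℓ
    t = 3 ℕ.* (Δ ℕ.* Δ)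
    x F : ℚ
    x = ℕ→ℚ m
    F = frac (L ∸ 1) L

    homomorphic : x * (F * ℕ→ℚ L) + ℕ→ℚ L * (ℕ→ℚ t + ℕ→ℚ ℓ) ≡ ℕ→ℚ (m ℕ.* (L ∸ 1) ℕ.+ L ℕ.* (t ℕ.+ ℓ))
    homomorphic = begin-equality
      x * (F * ℕ→ℚ L) + ℕ→ℚ L * (ℕ→ℚ t + ℕ→ℚ ℓ)
        ≡⟨ cong₂ _+_ (cong (x *_) (frac*denominator (L ∸ 1) (ℕₚ.*-mono-≤ 1≤ℓ 1≤ℓ))) (cong (ℕ→ℚ L *_) (ℕ→ℚ-+ t ℓ)) ⟩
      x * ℕ→ℚ (L ∸ 1) + ℕ→ℚ L * ℕ→ℚ (t ℕ.+ ℓ)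
        ≡⟨ cong₂ _+_ (ℕ→ℚ-* m (L ∸ 1)) (ℕ→ℚ-* L (t ℕ.+ ℓ)) ⟩
      ℕ→ℚ (m ℕ.* (L ∸ 1)) + ℕ→ℚ (L ℕ.* (t ℕ.+ ℓ))
        ≡⟨ ℕ→ℚ-+ (m ℕ.* (L ∸ 1)) (L ℕ.* (t ℕ.+ ℓ)) ⟩
      ℕ→ℚ (m ℕ.* (L ∸ 1) ℕ.+ L ℕ.* (t ℕ.+ ℓ)) ∎

module LightClass {m ℓ} (G₁ G₂ : Graph m) (D : Decomp m ℓ) (D-almost : IsAlmostDecomp G₁ ℓ D)
                  (iA : Fin (m div ℓ)) (a b : Fin m) where

  open FinCounting
  open Graphs
  open Swap
  open Arithmetic using (counting-contradiction; m<ℓ*[m/ℓ]+ℓ)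
  open import Data.Nat using (ℕ; suc; _+_; _*_; _∸_; _≤_; _<_; z≤n; s≤s; >-nonZero⁻¹)
  import Data.Nat.Properties as ℕₚ
  open import Data.Nat.Properties using (≤-trans; ≤-reflexive; *-monoʳ-≤; *-monoˡ-≤; +-mono-≤; m≤m+n; m≤n+m; <⇒≱; _<?_; m∸n+n≡m)
  open import Data.Fin using (Fin; _≟_)
  import Data.Fin.Properties as Finₚ
  open import Data.Fin.Subset using (Subset; _∈_; _∉_; _∪_; _-_; ⁅_⁆; ∣_∣)
  open import Data.Fin.Subset.Properties using (_∈?_; x∈p∪q⁻; x∈p∪q⁺; p─q⊆p)
  open import Data.Product using (∃; _×_; _,_; proj₁; proj₂)
  open import Data.Sum using (_⊎_; inj₁; inj₂; [_,_])
  open import Data.Empty using (⊥; ⊥-elim)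
  open import Function using (_∘_; id)
  open import Relation.Nullary using (¬_; yes; no; contradiction; ¬?; _×-dec_; _⊎-dec_)
  open import Relation.Nullary.Decidable using (decidable-stable)
  open import Relation.Unary using (Pred; Decidable; _⊆_)
  open import Relation.Binary.PropositionalEquality using (_≡_; _≢_; refl; sym; trans; cong; subst)
  open import Algebra.Properties.Semiring.Sum ℕₚ.+-*-semiring using (sum; ∑-distrib-+; *-distribˡ-sum)
  open ℕₚ.≤-Reasoning

  class-size : ∀ i → count (_∈? D i) ≡ ℓ
  class-size i = trans (sym (∣p∣≡count (D i))) (proj₁ D-almost i)

  class-unique : ∀ {x i j} → x ∈ D i → x ∈ D j → i ≡ j
  class-unique {x} {i} {j} x∈i x∈j with i ≟ j
  ... | yes i≡j = i≡j
  ... | no i≢j  = ⊥-elim (proj₁ (proj₂ D-almost) i j i≢j x x∈i x∈j)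

  SameClass : Fin m → Pred (Fin m) _
  SameClass x w = ∃ λ j → x ∈ D j × w ∈ D j

  SameClass? : ∀ x → Decidable (SameClass x)
  SameClass? x w = Finₚ.any? (λ j → (x ∈? D j) ×-dec (w ∈? D j))

  count-SameClass : ∀ x → count (SameClass? x) ≤ ℓ
  count-SameClass x with Finₚ.any? (λ j → x ∈? D j)
  ... | yes (j , x∈j) = ≤-trans (count-mono (SameClass? x) (_∈? D j) in-j) (≤-reflexive (class-size j))
    where
    in-j : SameClass x ⊆ (_∈ D j)
    in-j (j′ , x∈j′ , w∈j′) = subst (λ k → _ ∈ D k) (class-unique x∈j′ x∈j) w∈j′
  ... | no x∉D        = ≤-trans (≤-reflexive (count-∅ (SameClass? x) (λ w (j , x∈j , _) → x∉D (j , x∈j)))) z≤n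

  Classmates : ∀ {p} → Pred (Fin m) p → Pred (Fin m) _
  Classmates X w = ∃ λ x → X x × SameClass x w

  Classmates? : ∀ {p} {X : Pred (Fin m) p} → Decidable X → Decidable (Classmates X)
  Classmates? X? w = Finₚ.any? (λ x → X? x ×-dec SameClass? x w)

  RedNbrs : ∀ {p} → Pred (Fin m) p → Pred (Fin m) _
  RedNbrs X w = ∃ λ x → X x × Edge G₂ x w

  RedNbrs? : ∀ {p} {X : Pred (Fin m) p} → Decidable X → Decidable (RedNbrs X)
  RedNbrs? X? w = Finₚ.any? (λ x → X? x ×-dec Edge? G₂ x w)

  Unjoined : Pred (Fin m) _
  Unjoined w = ∃ λ v → v ∈ D iA × NonNeighbour G₁ v w

  Unjoined? : Decidable Unjoined
  Unjoined? w = Finₚ.any? (λ v → (v ∈? D iA) ×-dec NonNeighbour? G₁ v w)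

  RedNbr-a⁺ : Pred (Fin m) _
  RedNbr-a⁺ x = Edge G₂ a x ⊎ x ≡ b

  RedNbr-a⁺? : Decidable RedNbr-a⁺
  RedNbr-a⁺? x = Edge? G₂ a x ⊎-dec (x ≟ b)

  RedNear-A : Pred (Fin m) _
  RedNear-A = RedNbrs (Classmates (RedNbrs (_∈ D iA)))

  RedNear-A? : Decidable RedNear-A
  RedNear-A? = RedNbrs? (Classmates? (RedNbrs? (_∈? D iA)))

  RedNear-a : Pred (Fin m) _
  RedNear-a = RedNbrs (Classmates RedNbr-a⁺)

  RedNear-a? : Decidable RedNear-a
  RedNear-a? = RedNbrs? (Classmates? RedNbr-a⁺?)

  Blocked : Pred (Fin m) _
  Blocked w = Unjoined w ⊎ RedNear-a w

  Blocked? : Decidable Blocked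
  Blocked? w = Unjoined? w ⊎-dec RedNear-a? w

  in-class : ∀ {p} {X : Pred (Fin m) p} (j : Fin (m div ℓ)) → Decidable X → Decidable (λ w → w ∈ D j × X w)
  in-class j X? w = (w ∈? D j) ×-dec X? w

  weight : Fin (m div ℓ) → ℕ
  weight j = ℓ * count (in-class j Blocked?) + count (in-class j RedNear-A?)

  light⇒unblocked : ∀ {j} → weight j < ℓ → ∀ {w} → w ∈ D j → ¬ Blocked w
  light⇒unblocked {j} light w∈j blocked = <⇒≱ light (begin
    ℓ                                ≡⟨ sym (ℕₚ.*-identityʳ ℓ) ⟩
    ℓ * 1                            ≤⟨ *-monoʳ-≤ ℓ (count-pos (in-class j Blocked?) (w∈j , blocked)) ⟩
    ℓ * count (in-class j Blocked?)  ≤⟨ m≤m+n _ _ ⟩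
    weight j                         ∎)

  light⇒exchangeable : ∀ {j} → weight j < ℓ → ∃ λ c → c ∈ D j × ¬ RedNear-A c
  light⇒exchangeable {j} light with count-<-witness (in-class j RedNear-A?) (_∈? D j) fewer
    where
    fewer : count (in-class j RedNear-A?) < count (_∈? D j)
    fewer = begin-strict
      count (in-class j RedNear-A?)  ≤⟨ m≤n+m _ _ ⟩
      weight j                       <⟨ light ⟩
      ℓ                              ≡⟨ sym (class-size j) ⟩
      count (_∈? D j)                ∎
  ... | c , c∈j , ¬near = c , c∈j , λ near → ¬near (c∈j , near)

  module Counting {δ Δ} (δ≤deg₁ : ∀ v → δ ≤ deg G₁ v) (deg₂≤Δ : ∀ v → deg G₂ v ≤ Δ) where

    e : ℕ
    e = m ∸ suc δ

    e+1+δ≡m : e + suc δ ≡ m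
    e+1+δ≡m = m∸n+n≡m (begin
      suc δ                                       ≤⟨ s≤s (δ≤deg₁ a) ⟩
      suc (deg G₁ a)                              ≤⟨ m≤n+m _ _ ⟩
      count (NonNeighbour? G₁ a) + suc (deg G₁ a)  ≡⟨ count-NonNeighbour G₁ a ⟩
      m                                           ∎)

    count-NonNeighbour≤e : ∀ v → count (NonNeighbour? G₁ v) ≤ e
    count-NonNeighbour≤e v = begin
      count (NonNeighbour? G₁ v)                                    ≡⟨ sym (ℕₚ.m+n∸n≡m _ (suc (deg G₁ v))) ⟩
      count (NonNeighbour? G₁ v) + suc (deg G₁ v) ∸ suc (deg G₁ v)  ≡⟨ cong (_∸ suc (deg G₁ v)) (count-NonNeighbour G₁ v) ⟩
      m ∸ suc (deg G₁ v)                                            ≤⟨ ℕₚ.∸-monoʳ-≤ m (s≤s (δ≤deg₁ v)) ⟩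
      e                                                             ∎

    count-Edge₂≤Δ : ∀ v → count (Edge? G₂ v) ≤ Δ
    count-Edge₂≤Δ v = ≤-trans (≤-reflexive (sym (deg≡count G₂ v))) (deg₂≤Δ v)

    count-Classmates : ∀ {p} {X : Pred (Fin m) p} (X? : Decidable X) → count (Classmates? X?) ≤ count X? * ℓ
    count-Classmates X? = count-⋃ (Classmates? X?) X? SameClass? id (λ _ → count-SameClass _)

    count-RedNbrs : ∀ {p} {X : Pred (Fin m) p} (X? : Decidable X) → count (RedNbrs? X?) ≤ count X? * Δ
    count-RedNbrs X? = count-⋃ (RedNbrs? X?) X? (Edge? G₂) id (λ {v} _ → count-Edge₂≤Δ v)

    count-Unjoined : count Unjoined? ≤ ℓ * e
    count-Unjoined = ≤-trans (count-⋃ Unjoined? (_∈? D iA) (NonNeighbour? G₁) id (λ {v} _ → count-NonNeighbour≤e v))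
                             (≤-reflexive (cong (_* e) (class-size iA)))

    count-RedNear-A : count RedNear-A? ≤ ℓ * Δ * ℓ * Δ
    count-RedNear-A = begin
      count RedNear-A?                                   ≤⟨ count-RedNbrs (Classmates? (RedNbrs? (_∈? D iA))) ⟩
      count (Classmates? (RedNbrs? (_∈? D iA))) * Δ      ≤⟨ *-monoˡ-≤ Δ (count-Classmates (RedNbrs? (_∈? D iA))) ⟩
      count (RedNbrs? (_∈? D iA)) * ℓ * Δ                ≤⟨ *-monoˡ-≤ Δ (*-monoˡ-≤ ℓ (count-RedNbrs (_∈? D iA))) ⟩
      count (_∈? D iA) * Δ * ℓ * Δ                       ≡⟨ cong (λ k → k * Δ * ℓ * Δ) (class-size iA) ⟩
      ℓ * Δ * ℓ * Δ                                      ∎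

    count-RedNear-a : count RedNear-a? ≤ (Δ + 1) * ℓ * Δ
    count-RedNear-a = begin
      count RedNear-a?                        ≤⟨ count-RedNbrs (Classmates? RedNbr-a⁺?) ⟩
      count (Classmates? RedNbr-a⁺?) * Δ      ≤⟨ *-monoˡ-≤ Δ (count-Classmates RedNbr-a⁺?) ⟩
      count RedNbr-a⁺? * ℓ * Δ                ≤⟨ *-monoˡ-≤ Δ (*-monoˡ-≤ ℓ count-RedNbr-a⁺) ⟩
      (Δ + 1) * ℓ * Δ                         ∎
      where
      count-RedNbr-a⁺ : count RedNbr-a⁺? ≤ Δ + 1
      count-RedNbr-a⁺ = ≤-trans (count-∪ (Edge? G₂ a) (_≟ b)) (+-mono-≤ (count-Edge₂≤Δ a) (≤-reflexive (count-singleton b)))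

    count-Blocked : count Blocked? ≤ ℓ * e + (Δ + 1) * ℓ * Δ
    count-Blocked = ≤-trans (count-∪ Unjoined? RedNear-a?) (+-mono-≤ count-Unjoined count-RedNear-a)

    sum-weight : sum weight ≤ ℓ * (ℓ * e + (Δ + 1) * ℓ * Δ) + ℓ * Δ * ℓ * Δ
    sum-weight = begin
      sum weight
        ≡⟨ ∑-distrib-+ (λ j → ℓ * count (in-class j Blocked?)) (λ j → count (in-class j RedNear-A?)) ⟩
      sum (λ j → ℓ * count (in-class j Blocked?)) + sum (λ j → count (in-class j RedNear-A?))
        ≡⟨ cong (_+ sum (λ j → count (in-class j RedNear-A?))) (sym (*-distribˡ-sum ℓ (λ j → count (in-class j Blocked?)))) ⟩
      ℓ * sum (λ j → count (in-class j Blocked?)) + sum (λ j → count (in-class j RedNear-A?))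
        ≤⟨ +-mono-≤ (*-monoʳ-≤ ℓ (∑-count-disjoint (λ j w → w ∈? D j) Blocked? class-unique))
                    (∑-count-disjoint (λ j w → w ∈? D j) RedNear-A? class-unique) ⟩
      ℓ * count Blocked? + count RedNear-A?
        ≤⟨ +-mono-≤ (*-monoʳ-≤ ℓ count-Blocked) count-RedNear-A ⟩
      ℓ * (ℓ * e + (Δ + 1) * ℓ * Δ) + ℓ * Δ * ℓ * Δ ∎

    light-class : 2 ≤ ℓ → m * (ℓ * ℓ ∸ 1) + ℓ * ℓ * (3 * (Δ * Δ) + ℓ) ≤ ℓ * ℓ * δ →
                  ∃ λ j → j ≢ iA × weight j < ℓ
    light-class 2≤ℓ dense with Finₚ.any? (λ j → ¬? (j ≟ iA) ×-dec (weight j <? ℓ))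
    ... | yes light = light
    ... | no none   = ⊥-elim (counting-contradiction 2≤ℓ (>-nonZero⁻¹ _ {{Finₚ.nonZeroIndex iA}}) dense e+1+δ≡m
                                (m<ℓ*[m/ℓ]+ℓ m (ℕₚ.<⇒≤ 2≤ℓ))
                                (≤-trans (sum-≥-except weight iA heavy) sum-weight))
      where
      heavy : ∀ j → j ≢ iA → ℓ ≤ weight j
      heavy j j≢iA = ℕₚ.≮⇒≥ (λ light → none (j , j≢iA , light))

  module Exchange (G₁∩G₂=∅ : EdgeDisjoint G₁ G₂) (noBag : NoAltBag ℓ (Edge G₂) D)
                  {iB} (iA≢iB : iA ≢ iB) (a∈A : a ∈ D iA) (b∈B : b ∈ D iB) (ab∉G₁ : ¬ Edge G₁ a b)
                  {iC} (iC≢iA : iC ≢ iA) (C-unblocked : ∀ {w} → w ∈ D iC → ¬ Blocked w)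
                  {c} (c∈C : c ∈ D iC) (c-unreachable : ¬ RedNear-A c) where

    private
      A C A′ C′ : Subset m
      A  = D iA
      C  = D iC
      A′ = (A - a) ∪ ⁅ c ⁆
      C′ = (C - c) ∪ ⁅ a ⁆

      R⁺ : Fin m → Fin m → Set
      R⁺ = EdgePlus G₂ a b

    disjoint : ∀ {i j x} → i ≢ j → x ∈ D i → x ∉ D j
    disjoint i≢j x∈i x∈j = proj₁ (proj₂ D-almost) _ _ i≢j _ x∈i x∈j

    ∉A⇒≢a : ∀ {j x} → j ≢ iA → x ∈ D j → x ≢ a
    ∉A⇒≢a j≢iA x∈j refl = disjoint (j≢iA ∘ sym) a∈A x∈j

    a≢b : a ≢ b
    a≢b refl = disjoint iA≢iB a∈A b∈B

    c≢a : c ≢ a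
    c≢a = ∉A⇒≢a iC≢iA c∈C

    joined : ∀ {u v} → u ∈ A → v ∈ C → u ≢ v → Edge G₁ u v
    joined {u} {v} u∈A v∈C u≢v = decidable-stable (Edge? G₁ u v) λ ¬uv →
      C-unblocked v∈C (inj₁ (u , u∈A , [ u≢v ∘ sym , ¬uv ]))

    iC≢iB : iC ≢ iB
    iC≢iB refl = ab∉G₁ (joined a∈A b∈B a≢b)

    compound : CompoundPair G₁ A C
    compound u v u∈ v∈ u≢v with x∈p∪q⁻ A C u∈ | x∈p∪q⁻ A C v∈
    ... | inj₁ u∈A | inj₁ v∈A = proj₂ (proj₂ D-almost) iA u v u∈A v∈A u≢v
    ... | inj₁ u∈A | inj₂ v∈C = joined u∈A v∈C u≢v
    ... | inj₂ u∈C | inj₁ v∈A = Edge-sym G₁ (joined v∈A u∈C (u≢v ∘ sym))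
    ... | inj₂ u∈C | inj₂ v∈C = proj₂ (proj₂ D-almost) iC u v u∈C v∈C u≢v

    A′⊆A∪C : ∀ {x} → x ∈ A′ → x ∈ A ∪ C
    A′⊆A∪C x∈ with ∈-exchange⁻ A a c x∈
    ... | inj₁ (x∈A , _) = x∈p∪q⁺ (inj₁ x∈A)
    ... | inj₂ refl      = x∈p∪q⁺ (inj₂ c∈C)

    C′⊆A∪C : ∀ {x} → x ∈ C′ → x ∈ A ∪ C
    C′⊆A∪C x∈ with ∈-exchange⁻ C c a x∈
    ... | inj₁ (x∈C , _) = x∈p∪q⁺ (inj₂ x∈C)
    ... | inj₂ refl      = x∈p∪q⁺ (inj₁ a∈A)

    A′∌a : ∀ {x} → x ∈ A′ → x ≢ a
    A′∌a x∈ with ∈-exchange⁻ A a c x∈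
    ... | inj₁ (_ , x≢a) = x≢a
    ... | inj₂ refl      = c≢a

    A′∩C′=∅ : ∀ x → x ∈ A′ → x ∈ C′ → ⊥
    A′∩C′=∅ x x∈A′ x∈C′ with ∈-exchange⁻ A a c x∈A′ | ∈-exchange⁻ C c a x∈C′
    ... | inj₁ (x∈A , _)   | inj₁ (x∈C , _)   = disjoint (iC≢iA ∘ sym) x∈A x∈C
    ... | inj₁ (_ , x≢a)   | inj₂ x≡a         = x≢a x≡a
    ... | inj₂ x≡c         | inj₁ (_ , x≢c)   = x≢c x≡c
    ... | inj₂ refl        | inj₂ c≡a         = c≢a c≡a

    A′∩D=∅ : ∀ j → j ≢ iA → j ≢ iC → ∀ x → x ∈ A′ → x ∈ D j → ⊥
    A′∩D=∅ j j≢iA j≢iC x x∈A′ x∈j with ∈-exchange⁻ A a c x∈A′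
    ... | inj₁ (x∈A , _) = disjoint (j≢iA ∘ sym) x∈A x∈j
    ... | inj₂ refl      = disjoint (j≢iC ∘ sym) c∈C x∈j

    C′∩D=∅ : ∀ j → j ≢ iA → j ≢ iC → ∀ x → x ∈ C′ → x ∈ D j → ⊥
    C′∩D=∅ j j≢iA j≢iC x x∈C′ x∈j with ∈-exchange⁻ C c a x∈C′
    ... | inj₁ (x∈C , _) = disjoint (j≢iC ∘ sym) x∈C x∈j
    ... | inj₂ refl      = disjoint (j≢iA ∘ sym) a∈A x∈j

    exchange-almost : IsAlmostDecomp G₁ ℓ (swapDecomp ℓ D iA iC a c)
    exchange-almost =
      swapDecomp-all D iA iC a c (λ X → ∣ X ∣ ≡ ℓ)
        (trans (∣exchange∣ A a c a∈A (disjoint iC≢iA c∈C)) (size iA))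
        (trans (∣exchange∣ C c a c∈C (disjoint (iC≢iA ∘ sym) a∈A)) (size iC))
        (λ i _ _ → size i) ,
      swapDecomp-pairwise D iA iC a c (λ X Y → ∀ x → x ∈ X → x ∈ Y → ⊥) (λ X∩Y=∅ x x∈Y x∈X → X∩Y=∅ x x∈X x∈Y)
        A′∩C′=∅ A′∩D=∅ C′∩D=∅ (λ i j i≢j _ _ _ _ → proj₁ (proj₂ D-almost) i j i≢j) ,
      swapDecomp-all D iA iC a c (Clique G₁)
        (Clique-⊆ {G = G₁} A′⊆A∪C compound) (Clique-⊆ {G = G₁} C′⊆A∪C compound) (λ i _ _ → clique i)
      where
      size : ∀ i → ∣ D i ∣ ≡ ℓ
      size = proj₁ D-almost
      clique : ∀ i → Clique G₁ (D i)
      clique = proj₂ (proj₂ D-almost)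

    RedNbr-a⁺-of : ∀ {y} → R⁺ a y → RedNbr-a⁺ y
    RedNbr-a⁺-of (inj₁ ay)              = inj₁ ay
    RedNbr-a⁺-of (inj₂ (inj₁ (_ , y≡b))) = inj₂ y≡b
    RedNbr-a⁺-of (inj₂ (inj₂ (a≡b , _))) = contradiction a≡b a≢b

    noBag-A′C′ : ¬ AltBag R⁺ A′ C′
    noBag-A′C′ (x₁ , y₁ , _ , _ , x₁∈ , y₁∈ , _ , _ , _ , _ , _ , _ , r₁ , _) with r₁
    ... | inj₁ red = G₁∩G₂=∅ x₁ y₁ (compound x₁ y₁ (A′⊆A∪C x₁∈) (C′⊆A∪C y₁∈) x₁≢y₁) red
      where
      x₁≢y₁ : x₁ ≢ y₁
      x₁≢y₁ refl = A′∩C′=∅ x₁ x₁∈ y₁∈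
    ... | inj₂ (inj₁ (x₁≡a , _)) = A′∌a x₁∈ x₁≡a
    ... | inj₂ (inj₂ (refl , _)) with ∈-exchange⁻ A a c x₁∈
    ...   | inj₁ (b∈A , _) = disjoint iA≢iB b∈A b∈B
    ...   | inj₂ refl      = disjoint iC≢iB c∈C b∈B

    noBag-A′D : ∀ j → j ≢ iA → j ≢ iC → ¬ AltBag R⁺ A′ (D j)
    noBag-A′D j j≢iA j≢iC bag with AltBag-exchange bag
    ... | inj₁ old = noBag iA j (j≢iA ∘ sym) (AltBag-map (p─q⊆p A ⁅ a ⁆) id
                       (λ x∈ y∈ → EdgePlus⇒Edge G₂ (x∈p-y⇒x≢y x∈) (∉A⇒≢a j≢iA y∈)) old)
    ... | inj₂ (y₁ , y₂ , y₁∈ , y₂∈ , cy₁ , x₂ , x₂∈A , x₂≢a , x₂y₂) =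
      c-unreachable (y₁ , (y₂ , (x₂ , x₂∈A , EdgePlus⇒Edge G₂ x₂≢a (∉A⇒≢a j≢iA y₂∈) x₂y₂) , (j , y₂∈ , y₁∈)) ,
                     Edge-sym G₂ (EdgePlus⇒Edge G₂ c≢a (∉A⇒≢a j≢iA y₁∈) cy₁))

    noBag-C′D : ∀ j → j ≢ iA → j ≢ iC → ¬ AltBag R⁺ C′ (D j)
    noBag-C′D j j≢iA j≢iC bag with AltBag-exchange bag
    ... | inj₁ old = noBag iC j (j≢iC ∘ sym) (AltBag-map (p─q⊆p C ⁅ c ⁆) id
                       (λ x∈ y∈ → EdgePlus⇒Edge G₂ (∉A⇒≢a iC≢iA (p─q⊆p C ⁅ c ⁆ x∈)) (∉A⇒≢a j≢iA y∈)) old)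
    ... | inj₂ (y₁ , y₂ , y₁∈ , y₂∈ , ay₁ , x₂ , x₂∈C , _ , x₂y₂) =
      C-unblocked x₂∈C (inj₂ (y₂ , (y₁ , RedNbr-a⁺-of ay₁ , (j , y₁∈ , y₂∈)) ,
                              Edge-sym G₂ (EdgePlus⇒Edge G₂ (∉A⇒≢a iC≢iA x₂∈C) (∉A⇒≢a j≢iA y₂∈) x₂y₂)))

    exchange-noBag : NoAltBag ℓ R⁺ (swapDecomp ℓ D iA iC a c)
    exchange-noBag = swapDecomp-pairwise D iA iC a c (λ X Y → ¬ AltBag R⁺ X Y) (λ ¬XY → ¬XY ∘ AltBag-sym (EdgePlus-sym G₂))
      noBag-A′C′ noBag-A′D noBag-C′D
      (λ i j i≢j i≢iA _ j≢iA _ → noBag i j i≢j ∘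
        AltBag-map id id (λ x∈ y∈ → EdgePlus⇒Edge G₂ (∉A⇒≢a i≢iA x∈) (∉A⇒≢a j≢iA y∈)))

open import Defs
open import Data.Nat as ℕ using (ℕ; _*_; _∸_)
open import Data.Rational using (ℚ; 0ℚ; _≤_; _<_; _+_; _-_) renaming (_*_ to _*ℚ_)
open import Data.Fin using (Fin)
open import Data.Fin.Subset using (_∈_)
open import Data.Product using (Σ; ∃; _×_)
open import Relation.Nullary using (¬_)
open import Relation.Binary.PropositionalEquality using (_≢_)

open import Data.Nat.Properties using (<⇒≤)
open import Data.Product using (_,_)
open FinCounting using (minimiser; maximiser)
open DegreeConditions using (degree-conditions-ℕ)

lemma3 : (ℓ : ℕ) → 2 ℕ.≤ ℓ → (α : ℚ) → 0ℚ < α → α < frac 1 (ℓ * ℓ) →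
    ∃ λ (M : ℕ) → (m : ℕ) → M ℕ.≤ m →
    (G₁ G₂ : Graph m) → EdgeDisjoint G₁ G₂ →
    (∀ v → ℕ→ℚ m *ℚ (frac (ℓ * ℓ ∸ 1) (ℓ * ℓ) + α) ≤ ℕ→ℚ (deg G₁ v)) →
    (∀ v → ℕ→ℚ (3 * (deg G₂ v * deg G₂ v)) ≤ ℕ→ℚ m *ℚ α - ℕ→ℚ ℓ) →
    (D : Decomp m ℓ) → IsAlmostDecomp G₁ ℓ D →
    (iA iB : Fin (m div ℓ)) → iA ≢ iB →
    (a b : Fin m) → a ∈ D iA → b ∈ D iB →
    ¬ Edge G₁ a b → ¬ Edge G₂ a b →
    NoAltBag ℓ (Edge G₂) D →
    Σ (Fin (m div ℓ)) λ iC → Σ (Fin m) λ c →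
      iC ≢ iA × c ∈ D iC ×
      CompoundPair G₁ (D iA) (D iC) ×
      IsAlmostDecomp G₁ ℓ (swapDecomp ℓ D iA iC a c) ×
      NoAltBag ℓ (EdgePlus G₂ a b) (swapDecomp ℓ D iA iC a c)
lemma3 ℓ 2≤ℓ α _ _ =
  0 , λ m _ G₁ G₂ G₁∩G₂=∅ dense sparse D D-almost iA iB iA≢iB a b a∈A b∈B ab∉G₁ _ noBag →
  let (u , δ-min) = minimiser (deg G₁) a
      (w , Δ-max) = maximiser (deg G₂) a
      open LightClass G₁ G₂ D D-almost iA a b
      open Counting δ-min Δ-max
      (iC , iC≢iA , light) = light-class 2≤ℓ (degree-conditions-ℕ ℓ m (deg G₁ u) (deg G₂ w) α (<⇒≤ 2≤ℓ) (dense u) (sparse w))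
      (c , c∈C , c-unreachable) = light⇒exchangeable light
      open Exchange G₁∩G₂=∅ noBag iA≢iB a∈A b∈B ab∉G₁ iC≢iA (light⇒unblocked light) c∈C c-unreachable
  in iC , c , iC≢iA , c∈C , compound , exchange-almost , exchange-noBag
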